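{- A tree $T$ of order $n\ge 4$ is $2$-metric dimensional if and only if $T$ contains a support vertex which is adjacent to at least two leaves.
   Context: For a connected graph with shortest-path distance $d$: a set $S$ of vertices is a $k$-metric generator if every pair of distinct vertices $x,y$ has at least $k$ elements $w\in S$ with $d(x,w)\ne d(y,w)$; the graph is $k$-metric dimensional if $k$ is the largest integer for which a $k$-metric generator exists. A leaf is a vertex of degree one; a support vertex is a vertex adjacent to a leaf. -}

module Defs where

open import Data.Nat using (ℕ; zero; suc; _≤_; _≥_)
open import Data.Fin using (Fin)
open import Data.Fin.Subset using (Subset; _∈_)
open import Data.List using (List; []; _∷_; length)
open import Data.List.Relation.Unary.All using (All)
open import Data.List.Relation.Unary.Unique.Propositional using (Unique)
open import Data.Product using (Σ; ∃; _×_; _,_)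
open import Relation.Binary.PropositionalEquality using (_≡_; _≢_)
open import Relation.Nullary using (¬_)
open import Data.Empty using (⊥)

record Graph (n : ℕ) : Set₁ where
  field
    Adj   : Fin n → Fin n → Set
    sym   : ∀ {x y} → Adj x y → Adj y x
    irrefl : ∀ {x} → ¬ Adj x x
open Graph public

module _ {n : ℕ} (G : Graph n) where

  data Walk : Fin n → Fin n → ℕ → Set where
    here : ∀ {x} → Walk x x zero
    step : ∀ {x y z k} → Adj G x y → Walk y z k → Walk x z (suc k)

  Connected : Set
  Connected = ∀ x y → ∃ λ k → Walk x y k

  -- shortest-path distance, as a relation: d(x,y) = k
  IsDist : Fin n → Fin n → ℕ → Set
  IsDist x y k = Walk x y k × (∀ m → Walk x y m → k ≤ m)

  data Chain : List (Fin n) → Set where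
    nil  : Chain []
    one  : ∀ {x} → Chain (x ∷ [])
    cons : ∀ {x y vs} → Adj G x y → Chain (y ∷ vs) → Chain (x ∷ y ∷ vs)

  -- a cycle: distinct vertices v0,v1,...,vm (m ≥ 2), consecutive adjacent, vm adjacent to v0
  data Last : List (Fin n) → Fin n → Set where
    lastOne  : ∀ {x} → Last (x ∷ []) x
    lastCons : ∀ {x y vs z} → Last (y ∷ vs) z → Last (x ∷ y ∷ vs) z

  HasCycle : Set
  HasCycle = Σ (Fin n) λ v0 → Σ (List (Fin n)) λ rest → Σ (Fin n) λ vm →
    (length rest ≥ 2) × Unique (v0 ∷ rest) × Chain (v0 ∷ rest)
    × Last (v0 ∷ rest) vm × Adj G vm v0

  IsTree : Set
  IsTree = Connected × ¬ HasCycle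

  Leaf : Fin n → Set
  Leaf v = Σ (Fin n) λ u → Adj G v u × (∀ w → Adj G v w → w ≡ u)

  SupportVertex : Fin n → Set
  SupportVertex s = Σ (Fin n) λ l → Leaf l × Adj G s l

  Resolves : Fin n → Fin n → Fin n → Set
  Resolves w x y = ∀ a b → IsDist x w a → IsDist y w b → a ≢ b

  IsKMetricGenerator : ℕ → Subset n → Set
  IsKMetricGenerator k S = ∀ x y → x ≢ y →
    Σ (List (Fin n)) λ ws → Unique ws × length ws ≡ k
      × All (λ w → w ∈ S) ws × All (λ w → Resolves w x y) ws

  HasKMetricGenerator : ℕ → Set
  HasKMetricGenerator k = Σ (Subset n) λ S → IsKMetricGenerator k S

  KMetricDimensional : ℕ → Set
  KMetricDimensional k = HasKMetricGenerator k × (∀ k′ → HasKMetricGenerator k′ → k′ ≤ k)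

module Submission where

-- Every vertex distinguishes itself from any other vertex, so in any graph
-- the whole vertex set is a 2-metric generator; the question is whether a
-- 3-metric generator exists.
--   * Twin leaves l₁, l₂ lie at the same distance from every other vertex,
--     so only l₁ and l₂ themselves distinguish them: no k ≥ 3 is possible. A third vertex adjacent to exactly one
--     of them distinguishes them. If there is none, x and y have the same
--     neighbours outside {x, y}. For adjacent x, y this produces a triangle
--     (the tree has a third vertex, reached by leaving {x, y} along an edge);
--     for non-adjacent x, y any two common neighbours would form a 4-cycle,
--     so x and y are twin leaves. Hence without twin leaves every pair has a
--     third resolving vertex, and the whole vertex set is a 3-metric generator.

open import Defs
open import Data.Nat using (ℕ; _≥_; zero; suc; _≤_; z≤n; s≤s; s≤s⁻¹)
open import Data.Nat.Properties using (_≤?_; ≰⇒>; ≤-refl; ≤-trans; ≤-antisym; n≤0⇒n≡0; m≤n⇒m<n∨m≡n)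
open import Data.Fin using (Fin; _≟_) renaming (zero to fzero; suc to fsuc)
open import Data.Fin.Properties using (any?)
open import Data.Fin.Subset using (⊤)
open import Data.Fin.Subset.Properties using (∈⊤)
open import Data.List using (List; []; _∷_)
open import Data.List.Relation.Unary.All using ([]; _∷_)
open import Data.List.Relation.Unary.Any using (Any; here; there)
open import Data.List.Relation.Unary.All.Properties using (¬Any⇒All¬)
open import Data.List.Relation.Unary.AllPairs using ([]; _∷_)
open import Data.List.Relation.Unary.Unique.Propositional using (Unique)
import Data.List.Membership.DecPropositional as DecMembership
open import Data.Product using (Σ; _×_; _,_; proj₁; proj₂)
open import Data.Sum using (_⊎_; inj₁; inj₂; map₁)
open import Data.Empty using (⊥; ⊥-elim)
open import Relation.Binary.Definitions using (DecidableEquality)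
open import Relation.Nullary using (¬_; Dec; yes; no)
open import Relation.Nullary.Decidable using (map′; _×-dec_; _⊎-dec_)
open import Relation.Binary.PropositionalEquality
  using (_≡_; _≢_; refl; trans; subst; ≢-sym) renaming (sym to ≡-sym)
open import Function.Bundles using (_⇔_; mk⇔)

InPair : {A : Set} → A → A → A → Set
InPair x y v = v ≡ x ⊎ v ≡ y

noThreeDistinctInPair : {A : Set} {x y a b c : A} → a ≢ b → a ≢ c → b ≢ c →
  InPair x y a → InPair x y b → InPair x y c → ⊥
noThreeDistinctInPair a≢b a≢c b≢c (inj₁ refl) (inj₁ refl) _ = a≢b refl
noThreeDistinctInPair a≢b a≢c b≢c (inj₂ refl) (inj₂ refl) _ = a≢b refl
noThreeDistinctInPair a≢b a≢c b≢c (inj₁ refl) (inj₂ refl) (inj₁ refl) = a≢c refl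
noThreeDistinctInPair a≢b a≢c b≢c (inj₁ refl) (inj₂ refl) (inj₂ refl) = b≢c refl
noThreeDistinctInPair a≢b a≢c b≢c (inj₂ refl) (inj₁ refl) (inj₁ refl) = b≢c refl
noThreeDistinctInPair a≢b a≢c b≢c (inj₂ refl) (inj₁ refl) (inj₂ refl) = a≢c refl

module _ {A : Set} (_≟A_ : DecidableEquality A) where

  inPair? : ∀ x y v → Dec (InPair x y v)
  inPair? x y v = (v ≟A x) ⊎-dec (v ≟A y)

  avoidPair : {a b c : A} → a ≢ b → a ≢ c → b ≢ c →
    ∀ x y → Σ A λ z → ¬ InPair x y z
  avoidPair {a} {b} {c} a≢b a≢c b≢c x y
    with inPair? x y a | inPair? x y b | inPair? x y c
  ... | no a∉ | _ | _ = a , a∉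
  ... | yes _ | no b∉ | _ = b , b∉
  ... | yes _ | yes _ | no c∉ = c , c∉
  ... | yes a∈ | yes b∈ | yes c∈ = ⊥-elim (noThreeDistinctInPair a≢b a≢c b≢c a∈ b∈ c∈)

everywhereOr : ∀ {m} {P : Fin m → Set} {B : Set} → (∀ i → P i ⊎ B) → (∀ i → P i) ⊎ B
everywhereOr {zero} f = inj₁ λ ()
everywhereOr {suc m} {P} f with f fzero | everywhereOr {P = λ i → P (fsuc i)} (λ i → f (fsuc i))
... | inj₂ b | _ = inj₂ b
... | inj₁ _ | inj₂ b = inj₂ b
... | inj₁ p₀ | inj₁ p = inj₁ λ { fzero → p₀ ; (fsuc i) → p i }

module _ {P : ℕ → Set} (P? : ∀ m → Dec (P m)) where

  Least : Set
  Least = Σ ℕ λ m → P m × (∀ j → P j → m ≤ j)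

  searchUpTo : ∀ k → (∀ j → j ≤ k → ¬ P j) ⊎ Least
  searchUpTo zero with P? zero
  ... | yes p = inj₂ (zero , p , λ _ _ → z≤n)
  ... | no ¬p = inj₁ λ { _ z≤n → ¬p }
  searchUpTo (suc k) with searchUpTo k
  ... | inj₂ least = inj₂ least
  ... | inj₁ none with P? (suc k)
  ...   | yes p = inj₂ (suc k , p , aboveNone)
    where
      aboveNone : ∀ j → P j → suc k ≤ j
      aboveNone j pj with j ≤? k
      ... | yes j≤k = ⊥-elim (none j j≤k pj)
      ... | no j≰k = ≰⇒> j≰k
  ...   | no ¬p = inj₁ upToSuc
    where
      upToSuc : ∀ j → j ≤ suc k → ¬ P j
      upToSuc j j≤ with m≤n⇒m<n∨m≡n j≤
      ... | inj₁ j<sk = none j (s≤s⁻¹ j<sk)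
      ... | inj₂ refl = ¬p

  leastWitness : ∀ {k} → P k → Least
  leastWitness {k} pk with searchUpTo k
  ... | inj₁ none = ⊥-elim (none k ≤-refl pk)
  ... | inj₂ least = least

module _ {n : ℕ} (G : Graph n) where

  DecidableAdjacency : Set
  DecidableAdjacency = ∀ x y → Dec (Adj G x y)

  adj⇒≢ : ∀ {a b} → Adj G a b → a ≢ b
  adj⇒≢ {a} e refl = irrefl G e

  resolvesSym : ∀ {w x y} → Resolves G w x y → Resolves G w y x
  resolvesSym r b a db da b≡a = r a b da db (≡-sym b≡a)

  vertexResolvesItself : ∀ {x y} → x ≢ y → Resolves G x x y
  vertexResolvesItself x≢y a b (_ , minimal) (walk , _) a≡b
    with n≤0⇒n≡0 (minimal 0 here)
  ... | refl with a≡b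
  ... | refl with walk
  ... | here = x≢y refl

  nonNeighbourFar : ∀ {y w b} → y ≢ w → ¬ Adj G y w → Walk G y w b → 2 ≤ b
  nonNeighbourFar y≢w _ here = ⊥-elim (y≢w refl)
  nonNeighbourFar _ ¬yw (step e here) = ⊥-elim (¬yw e)
  nonNeighbourFar _ _ (step _ (step _ _)) = s≤s (s≤s z≤n)

  -- A neighbour of x that is not a neighbour of y (nor y itself) is at
  -- distance 1 from x and at least 2 from y, hence resolves x and y.
  exclusiveNeighbourResolves : ∀ {w x y} → y ≢ w → Adj G x w → ¬ Adj G y w →
    Resolves G w x y
  exclusiveNeighbourResolves y≢w xw ¬yw a b (_ , minimal) (walk , _) refl
    with ≤-trans (nonNeighbourFar y≢w ¬yw walk) (minimal 1 (step xw here))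
  ... | s≤s ()

  ThirdResolver : Fin n → Fin n → Set
  ThirdResolver x y = Σ (Fin n) λ w → ¬ InPair x y w × Resolves G w x y

  -- In every graph the full vertex set is a 2-metric generator: each pair
  -- is resolved by its own two vertices.
  fullSetIs2Generator : IsKMetricGenerator G 2 ⊤
  fullSetIs2Generator x y x≢y =
    x ∷ y ∷ [] , (x≢y ∷ []) ∷ [] ∷ [] , refl , ∈⊤ ∷ ∈⊤ ∷ [] ,
    vertexResolvesItself x≢y ∷ resolvesSym (vertexResolvesItself (≢-sym x≢y)) ∷ []

  fullSetIs3Generator : (∀ x y → x ≢ y → ThirdResolver x y) → IsKMetricGenerator G 3 ⊤
  fullSetIs3Generator third x y x≢y with third x y x≢y
  ... | w , w∉ , r =
    x ∷ y ∷ w ∷ [] ,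
    (x≢y ∷ (λ x≡w → w∉ (inj₁ (≡-sym x≡w))) ∷ []) ∷ ((λ y≡w → w∉ (inj₂ (≡-sym y≡w))) ∷ []) ∷ [] ∷ [] ,
    refl , ∈⊤ ∷ ∈⊤ ∷ ∈⊤ ∷ [] ,
    vertexResolvesItself x≢y ∷ resolvesSym (vertexResolvesItself (≢-sym x≢y)) ∷ r ∷ []

  -- A pair resolved only by its own vertices limits every k-metric generator
  -- to k ≤ 2: k resolvers must be k distinct vertices of the pair.
  pairResolvedOnlyByItself⇒k≤2 : ∀ {x y} → x ≢ y → (∀ w → Resolves G w x y → InPair x y w) →
    ∀ k → HasKMetricGenerator G k → k ≤ 2
  pairResolvedOnlyByItself⇒k≤2 _ _ zero _ = z≤n
  pairResolvedOnlyByItself⇒k≤2 _ _ (suc zero) _ = s≤s z≤n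
  pairResolvedOnlyByItself⇒k≤2 _ _ (suc (suc zero)) _ = s≤s (s≤s z≤n)
  pairResolvedOnlyByItself⇒k≤2 {x} {y} x≢y only (suc (suc (suc _))) (_ , generator)
    with generator x y x≢y
  ... | a ∷ b ∷ c ∷ _ , (a≢b ∷ a≢c ∷ _) ∷ (b≢c ∷ _) ∷ _ , _ , _ , ra ∷ rb ∷ rc ∷ _ =
    ⊥-elim (noThreeDistinctInPair a≢b a≢c b≢c (only a ra) (only b rb) (only c rc))

  -- With decidable adjacency, walks of a given length are decidable, so in a
  -- connected graph every distance exists (as the least walk length).
  walk? : DecidableAdjacency → ∀ m x y → Dec (Walk G x y m)
  walk? _ zero x y = map′ (λ { refl → here }) (λ { here → refl }) (x ≟ y)
  walk? adj? (suc m) x y =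
    map′ (λ { (_ , e , walk) → step e walk }) (λ { (step e walk) → _ , e , walk })
         (any? λ z → adj? x z ×-dec walk? adj? m z y)

  distanceExists : Connected G → DecidableAdjacency → ∀ x y → Σ ℕ λ k → IsDist G x y k
  distanceExists connected adj? x y = leastWitness (λ m → walk? adj? m x y) (proj₂ (connected x y))

  TwinLeaves : Set
  TwinLeaves = Σ (Fin n) λ s → SupportVertex G s × Σ (Fin n) λ l₁ → Σ (Fin n) λ l₂ →
    l₁ ≢ l₂ × Leaf G l₁ × Leaf G l₂ × Adj G s l₁ × Adj G s l₂

  -- Every walk out of a leaf l₁ passes through its neighbour s, so it can be
  -- rerouted to start at any other neighbour l₂ of s, with the same length.
  rerouteFromLeaf : ∀ {s l₁ l₂ w m} → Leaf G l₁ → Adj G s l₁ → Adj G s l₂ → w ≢ l₁ →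
    Walk G l₁ w m → Walk G l₂ w m
  rerouteFromLeaf _ _ _ w≢l₁ here = ⊥-elim (w≢l₁ refl)
  rerouteFromLeaf {s} (u , _ , onlyNeighbour) sl₁ sl₂ _ (step {y = z} e rest) =
    step (Graph.sym G sl₂) (subst (λ t → Walk G t _ _) z≡s rest)
    where
      z≡s : z ≡ s
      z≡s = trans (onlyNeighbour z e) (≡-sym (onlyNeighbour s (Graph.sym G sl₁)))

  -- Twin leaves are equidistant from every other vertex, so they are
  -- resolved only by themselves.
  twinLeavesResolvedOnlyByThemselves : Connected G → DecidableAdjacency →
    ∀ {s l₁ l₂} → Leaf G l₁ → Leaf G l₂ → Adj G s l₁ → Adj G s l₂ →
    ∀ w → Resolves G w l₁ l₂ → InPair l₁ l₂ w
  twinLeavesResolvedOnlyByThemselves connected adj? {l₁ = l₁} {l₂} leaf₁ leaf₂ sl₁ sl₂ w r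
    with w ≟ l₁ | w ≟ l₂
  ... | yes w≡l₁ | _ = inj₁ w≡l₁
  ... | no _ | yes w≡l₂ = inj₂ w≡l₂
  ... | no w≢l₁ | no w≢l₂
    with distanceExists connected adj? l₁ w | distanceExists connected adj? l₂ w
  ... | a , da@(walk₁ , minimal₁) | b , db@(walk₂ , minimal₂) =
    ⊥-elim (r a b da db (≤-antisym (minimal₁ b (rerouteFromLeaf leaf₂ sl₂ sl₁ w≢l₂ walk₂))
                                    (minimal₂ a (rerouteFromLeaf leaf₁ sl₁ sl₂ w≢l₁ walk₁))))

  exitEdge : ∀ {x y u z k} → Walk G u z k → InPair x y u → ¬ InPair x y z →
    Σ (Fin n) λ u′ → Σ (Fin n) λ w → InPair x y u′ × ¬ InPair x y w × Adj G u′ w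
  exitEdge here u∈ z∉ = ⊥-elim (z∉ u∈)
  exitEdge {x} {y} {u} (step {y = v} e walk) u∈ z∉ with inPair? _≟_ x y v
  ... | yes v∈ = exitEdge walk v∈ z∉
  ... | no v∉ = u , v , u∈ , v∉ , e

  NeighboursAgreeAt : Fin n → Fin n → Fin n → Set
  NeighboursAgreeAt x y w = ¬ InPair x y w → (Adj G x w → Adj G y w) × (Adj G y w → Adj G x w)

  -- Where x and y disagree, the vertex is an exclusive neighbour and
  -- therefore a third resolver.
  agreeOrResolve : DecidableAdjacency → ∀ x y w → NeighboursAgreeAt x y w ⊎ ThirdResolver x y
  agreeOrResolve adj? x y w with inPair? _≟_ x y w
  ... | yes w∈ = inj₁ λ w∉ → ⊥-elim (w∉ w∈)
  ... | no w∉ with adj? x w | adj? y w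
  ...   | yes xw | yes yw = inj₁ λ _ → (λ _ → yw) , (λ _ → xw)
  ...   | no ¬xw | no ¬yw = inj₁ λ _ → (λ xw → ⊥-elim (¬xw xw)) , (λ yw → ⊥-elim (¬yw yw))
  ...   | yes xw | no ¬yw =
    inj₂ (w , w∉ , exclusiveNeighbourResolves (λ y≡w → w∉ (inj₂ (≡-sym y≡w))) xw ¬yw)
  ...   | no ¬xw | yes yw =
    inj₂ (w , w∉ , resolvesSym (exclusiveNeighbourResolves (λ x≡w → w∉ (inj₁ (≡-sym x≡w))) yw ¬xw))

  record Path (x y : Fin n) : Set where
    constructor path
    field
      after  : List (Fin n)
      unique : Unique (x ∷ after)
      chain  : Chain G (x ∷ after)
      ends   : Last G (x ∷ after) y

  pathFrom : ∀ {x z} vs → Any (x ≡_) vs → Unique vs → Chain G vs → Last G vs z → Path x z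
  pathFrom (_ ∷ after) (here refl) u c l = path after u c l
  pathFrom (_ ∷ v ∷ after) (there x∈) (_ ∷ u) (cons _ c) (lastCons l) = pathFrom (v ∷ after) x∈ u c l

  open DecMembership (_≟_ {n}) using (_∈?_)

  -- Loop erasure: every walk contains a path between its endpoints.
  walkToPath : ∀ {x y k} → Walk G x y k → Path x y
  walkToPath here = path [] ([] ∷ []) one lastOne
  walkToPath {x} (step {y = v} e walk) with walkToPath walk
  ... | path after u c l with x ∈? (v ∷ after)
  ... | yes x∈ = pathFrom (v ∷ after) x∈ u c l
  ... | no x∉ = path (v ∷ after) (¬Any⇒All¬ _ x∉ ∷ u) (cons e c) (lastCons l)

  module _ (tree : IsTree G) where

    -- In a tree, x and y are adjacent iff the path between them has one
    -- edge: a longer path closed by the edge x–y would be a cycle.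
    treeAdjacency? : DecidableAdjacency
    treeAdjacency? x y with walkToPath (proj₂ (proj₁ tree x y))
    ... | path [] _ _ lastOne = no (irrefl G)
    ... | path (_ ∷ []) _ (cons e one) (lastCons lastOne) = yes e
    ... | path (a ∷ b ∷ after) u c l =
      no λ e → proj₂ tree (x , a ∷ b ∷ after , y , s≤s (s≤s z≤n) , u , c , l , Graph.sym G e)

    noTriangle : ∀ {x y w} → Adj G x y → Adj G y w → Adj G x w → ⊥
    noTriangle {x} {y} {w} xy yw xw =
      proj₂ tree (x , y ∷ w ∷ [] , w , s≤s (s≤s z≤n) ,
        (adj⇒≢ xy ∷ adj⇒≢ xw ∷ []) ∷ (adj⇒≢ yw ∷ []) ∷ [] ∷ [] ,
        cons xy (cons yw one) , lastCons (lastCons lastOne) , Graph.sym G xw)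

    noSquare : ∀ {x s y w} → Adj G x s → Adj G s y → Adj G y w → Adj G w x →
      x ≢ y → s ≢ w → ⊥
    noSquare {x} {s} {y} {w} xs sy yw wx x≢y s≢w =
      proj₂ tree (x , s ∷ y ∷ w ∷ [] , w , s≤s (s≤s z≤n) ,
        (adj⇒≢ xs ∷ x≢y ∷ ≢-sym (adj⇒≢ wx) ∷ []) ∷ (adj⇒≢ sy ∷ s≢w ∷ []) ∷ (adj⇒≢ yw ∷ []) ∷ [] ∷ [] ,
        cons xs (cons sy (cons yw one)) , lastCons (lastCons (lastCons lastOne)) , wx)

    -- Adjacent x, y cannot agree everywhere if some z lies outside {x, y}:
    -- the first edge leaving {x, y} towards z would close a triangle.
    adjacentPairDisagrees : ∀ {x y z} → Adj G x y → ¬ InPair x y z →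
      ¬ (∀ w → NeighboursAgreeAt x y w)
    adjacentPairDisagrees {x} {y} {z} xy z∉ agree
      with exitEdge (proj₂ (proj₁ tree x z)) (inj₁ refl) z∉
    ... | _ , w , inj₁ refl , w∉ , xw = noTriangle xy (proj₁ (agree w w∉) xw) xw
    ... | _ , w , inj₂ refl , w∉ , yw = noTriangle xy yw (proj₂ (agree w w∉) yw)

    -- Non-adjacent x ≠ y that agree everywhere share all neighbours; two
    -- common neighbours would close a 4-cycle, so x, y are twin leaves.
    agreeingNonNeighboursAreTwins : ∀ {x y} → x ≢ y → ¬ Adj G x y →
      (∀ w → NeighboursAgreeAt x y w) → TwinLeaves
    agreeingNonNeighboursAreTwins {x} {y} x≢y ¬xy agree with proj₁ tree x y
    ... | _ , here = ⊥-elim (x≢y refl)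
    ... | _ , step {y = s} xs _ =
      s , (x , leafX , Graph.sym G xs) , x , y , x≢y , leafX , leafY ,
      Graph.sym G xs , Graph.sym G (xToY xs)
      where
        xToY : ∀ {w} → Adj G x w → Adj G y w
        xToY {w} xw = proj₁ (agree w λ { (inj₁ refl) → irrefl G xw ; (inj₂ refl) → ¬xy xw }) xw

        yToX : ∀ {w} → Adj G y w → Adj G x w
        yToX {w} yw = proj₂ (agree w λ { (inj₁ refl) → ¬xy (Graph.sym G yw) ; (inj₂ refl) → irrefl G yw }) yw

        onlyNeighbour : ∀ w → Adj G x w → w ≡ s
        onlyNeighbour w xw with w ≟ s
        ... | yes w≡s = w≡s
        ... | no w≢s = ⊥-elim (noSquare xs (Graph.sym G (xToY xs)) (xToY xw) (Graph.sym G xw) x≢y (≢-sym w≢s))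

        leafX : Leaf G x
        leafX = s , xs , onlyNeighbour

        leafY : Leaf G y
        leafY = s , xToY xs , λ w yw → onlyNeighbour w (yToX yw)

    thirdResolverOrTwins : (∀ x y → Σ (Fin n) λ z → ¬ InPair x y z) →
      ∀ x y → x ≢ y → ThirdResolver x y ⊎ TwinLeaves
    thirdResolverOrTwins outside x y x≢y with everywhereOr (agreeOrResolve treeAdjacency? x y)
    ... | inj₂ resolver = inj₁ resolver
    ... | inj₁ agree with treeAdjacency? x y
    ...   | yes xy = ⊥-elim (adjacentPairDisagrees xy (proj₂ (outside x y)) agree)
    ...   | no ¬xy = inj₂ (agreeingNonNeighboursAreTwins x≢y ¬xy agree)

    threeGeneratorOrTwins : (∀ x y → Σ (Fin n) λ z → ¬ InPair x y z) →
      HasKMetricGenerator G 3 ⊎ TwinLeaves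
    threeGeneratorOrTwins outside
      with everywhereOr (λ x → everywhereOr (resolverForPair x))
      where
        resolverForPair : ∀ x y → (x ≢ y → ThirdResolver x y) ⊎ TwinLeaves
        resolverForPair x y with x ≟ y
        ... | yes x≡y = inj₁ λ x≢y → ⊥-elim (x≢y x≡y)
        ... | no x≢y = map₁ (λ resolver _ → resolver) (thirdResolverOrTwins outside x y x≢y)
    ... | inj₁ resolvers = inj₁ (⊤ , fullSetIs3Generator resolvers)
    ... | inj₂ twins = inj₂ twins

-- Order ≥ 3 supplies the vertex
-- outside each pair.
corollary4 : (n : ℕ) → n ≥ 4 → (T : Graph n) → IsTree T →
    KMetricDimensional T 2 ⇔
      Σ (Fin n) λ s → SupportVertex T s × Σ (Fin n) λ l₁ → Σ (Fin n) λ l₂ →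
        l₁ ≢ l₂ × Leaf T l₁ × Leaf T l₂ × Adj T s l₁ × Adj T s l₂
corollary4 (suc (suc (suc (suc _)))) (s≤s (s≤s (s≤s (s≤s _)))) T tree = mk⇔ twinsFromDimension dimensionFromTwins
  where
    outside : ∀ x y → Σ (Fin _) λ z → ¬ InPair x y z
    outside = avoidPair _≟_ {fzero} {fsuc fzero} {fsuc (fsuc fzero)} (λ ()) (λ ()) (λ ())

    twinsFromDimension : KMetricDimensional T 2 → TwinLeaves T
    twinsFromDimension (_ , maximal) with threeGeneratorOrTwins T tree outside
    ... | inj₂ twins = twins
    ... | inj₁ generator with maximal 3 generator
    ...   | s≤s (s≤s ())

    dimensionFromTwins : TwinLeaves T → KMetricDimensional T 2
    dimensionFromTwins (_ , _ , _ , _ , l₁≢l₂ , leaf₁ , leaf₂ , sl₁ , sl₂) =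
      (⊤ , fullSetIs2Generator T) ,
      pairResolvedOnlyByItself⇒k≤2 T l₁≢l₂
        (twinLeavesResolvedOnlyByThemselves T (proj₁ tree) (treeAdjacency? T tree) leaf₁ leaf₂ sl₁ sl₂)
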